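{- The derivational difference logic of the class of all $T_1$-spaces equals $\mathbf{KT_1}$; that is, $\bigcap\{\mathbf{Ld}_{\neq}(X) : X \text{ a } T_1\text{ -space}\}=\mathbf{KT_1}$.
   Context: Formulas are built from countably many propositional variables using $\bot$, $\to$ and two unary modalities $\Box$ and $[\neq]$; $\langle\neq\rangle A:=\neg[\neq]\neg A$. A (normal bimodal) logic is a set of formulas containing all classical tautologies and the K-axioms for $\Box$ and $[\neq]$, closed under modus ponens, necessitation for both modalities, and substitution. $\mathbf{KT_1}$ is the least logic containing $\Box p\to\Box\Box p$, $p\wedge[\neq]p\to[\neq][\neq]p$, $\langle\neq\rangle[\neq]p\to p$, $[\neq]p\to\Box p$ and $[\neq]p\to[\neq]\Box p$. dd-semantics in a topological space $X$: for a valuation (assignment of subsets of $X$ to variables), $x\models\Box A$ iff there is an open $U\ni x$ with $y\models A$ for all $y\in U\setminus\{x\}$; $x\models[\neq]A$ iff $y\models A$ for all $y\ne x$; Boolean connectives classically. $\mathbf{Ld}_{\neq}(X)$ is the set of formulas true at all points of $X$ under all valuations. -}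

module Defs where

open import Level using (Level; Lift; lift) renaming (suc to lsuc; zero to lzero)
open import Data.Nat using (ℕ)
open import Data.Bool using (Bool; true; false; _∨_; not)
open import Data.Product using (Σ; _×_; _,_)
open import Data.Empty using (⊥)
open import Data.Unit using (⊤)
open import Relation.Binary.PropositionalEquality using (_≡_)
open import Relation.Nullary using (¬_)

infixr 5 _⇒_
data Fm : Set where
  var  : ℕ → Fm
  ⊥'   : Fm
  _⇒_  : Fm → Fm → Fm
  □    : Fm → Fm
  [≠]  : Fm → Fm

~_ : Fm → Fm
~ A = A ⇒ ⊥'

_∧'_ : Fm → Fm → Fm
A ∧' B = ~ (A ⇒ ~ B)

⟨≠⟩ : Fm → Fm
⟨≠⟩ A = ~ [≠] (~ A)

Subst : Set
Subst = ℕ → Fm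

sub : Subst → Fm → Fm
sub σ (var n) = σ n
sub σ ⊥' = ⊥'
sub σ (A ⇒ B) = sub σ A ⇒ sub σ B
sub σ (□ A) = □ (sub σ A)
sub σ ([≠] A) = [≠] (sub σ A)

evalB : (Fm → Bool) → Fm → Bool
evalB f (var n) = f (var n)
evalB f ⊥' = false
evalB f (A ⇒ B) = not (evalB f A) ∨ evalB f B
evalB f (□ A) = f (□ A)
evalB f ([≠] A) = f ([≠] A)

Tautology : Fm → Set
Tautology A = (f : Fm → Bool) → evalB f A ≡ true

p q : Fm
p = var 0
q = var 1

data KT1⊢_ : Fm → Set where
  taut   : ∀ {A} → Tautology A → KT1⊢ A
  K□     : KT1⊢ (□ (p ⇒ q) ⇒ (□ p ⇒ □ q))
  K≠     : KT1⊢ ([≠] (p ⇒ q) ⇒ ([≠] p ⇒ [≠] q))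
  ax4    : KT1⊢ (□ p ⇒ □ (□ p))
  axD4   : KT1⊢ ((p ∧' [≠] p) ⇒ [≠] ([≠] p))
  axB    : KT1⊢ (⟨≠⟩ ([≠] p) ⇒ p)
  ax≠□   : KT1⊢ ([≠] p ⇒ □ p)
  ax≠≠□  : KT1⊢ ([≠] p ⇒ [≠] (□ p))
  mp     : ∀ {A B} → KT1⊢ (A ⇒ B) → KT1⊢ A → KT1⊢ B
  nec□   : ∀ {A} → KT1⊢ A → KT1⊢ □ A
  nec≠   : ∀ {A} → KT1⊢ A → KT1⊢ [≠] A
  subst  : ∀ {A} (σ : Subst) → KT1⊢ A → KT1⊢ sub σ A

record Topology (X : Set) : Set₁ where
  field
    Open      : (X → Set) → Set
    open-univ : Open (λ _ → ⊤)
    open-∩    : ∀ {U V} → Open U → Open V → Open (λ x → U x × V x)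
    open-⋃    : (I : Set) (U : I → X → Set) → (∀ i → Open (U i))
                → Open (λ x → Σ I (λ i → U i x))

record T1Space : Set₁ where
  field
    Carrier  : Set
    topology : Topology Carrier
  open Topology topology public
  field
    T1 : ∀ (x y : Carrier) → ¬ x ≡ y →
         Σ (Carrier → Set) (λ U → Open U × U x × ¬ U y)

Valuation : Set → Set₁
Valuation X = ℕ → X → Set

module _ (S : T1Space) where
  open T1Space S

  _,_⊨_ : Valuation Carrier → Carrier → Fm → Set₁
  V , x ⊨ var n = Lift (lsuc lzero) (V n x)
  V , x ⊨ ⊥' = Lift (lsuc lzero) ⊥
  V , x ⊨ (A ⇒ B) = V , x ⊨ A → V , x ⊨ B
  V , x ⊨ □ A = Σ (Carrier → Set) (λ U → Open U × U x ×
                   (∀ y → U y → ¬ y ≡ x → V , y ⊨ A))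
  V , x ⊨ [≠] A = ∀ y → ¬ y ≡ x → V , y ⊨ A

  Ld≠ : Fm → Set₁
  Ld≠ A = (V : Valuation Carrier) (x : Carrier) → V , x ⊨ A

-- Soundness: each axiom holds in every T1 space; □p → □□p and [≠]p → [≠]□p hold because
-- a point y ≠ x has an open neighbourhood avoiding x.
--
-- Completeness: extend ~A to a maximal consistent Γ₀.  Γ₀ and its R≠-successors form a
-- cluster in which distinct theories are R≠-related (R≠ is symmetric by axB and, by axD4,
-- transitive between distinct theories).  The countermodel has one point for each
-- R≠-irreflexive theory of the cluster and a copy at every level n ∈ ℕ of each reflexive
-- one; a set is open if around each of its points x it contains every R□-successor of x
-- from some level on.  Distinct points are then R≠-related, the infinitely many copies of
-- R□-successors (which are reflexive) make □ the derived-set modality, and levels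
-- separate points, so the space is T1 and the truth lemma refutes A.

module Submission where

open import Defs
open import Level using (Level; 0ℓ; Lift; lift; lower) renaming (suc to lsuc)
open import Axiom.ExcludedMiddle using (ExcludedMiddle)
open import Data.Bool using (Bool; true; false; not; _∨_; _∧_; T)
open import Data.Bool.Properties using (T-∧; T-≡; ¬-not; T-irrelevant)
open import Data.Fin using (Fin; zero; suc)
open import Data.Nat using (ℕ; zero; suc; _+_; _∸_; _≤_; _<_; _≤′_; z≤n; s≤s; ≤′-refl; ≤′-step)
open import Data.Nat.Properties
  using (≤-refl; ≤-trans; ≤⇒≤′; n≤1+n; m≤m+n; m≤n+m; n∸n≡0; m+n∸n≡m; <-irrefl; <-cmp; 1+n≢n)
open import Data.Nat.Induction using (<-rec)
open import Data.Product using (Σ; _×_; _,_; proj₁; proj₂)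
open import Data.Sum using (_⊎_; inj₁; inj₂)
open import Data.Unit using (⊤; tt)
open import Data.Empty using (⊥; ⊥-elim)
open import Data.Vec using (Vec; []; _∷_; lookup; map)
open import Data.Vec.Properties using (lookup-map)
open import Function using (_∘_)
open import Function.Bundles using (_⇔_; mk⇔; Equivalence)
open import Relation.Nullary using (¬_; Dec; yes; no)
open import Relation.Nullary.Decidable using (True; isYes; toWitness; fromWitness; decidable-stable)
open import Relation.Binary.Definitions using (tri<; tri≈; tri>)
open import Relation.Binary.PropositionalEquality
  using (_≡_; _≢_; refl; sym; trans; cong; cong₂) renaming (subst to transport)

private variable
  n m : ℕ
  A B C : Fm

-- Propositional reasoning

infixr 5 _⇛_
data Schema (n : ℕ) : Set where
  atom   : Fin n → Schema n
  falsum : Schema n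
  _⇛_    : Schema n → Schema n → Schema n

¬ₛ_ : Schema n → Schema n
¬ₛ F = F ⇛ falsum

infix 6 _∧ₛ_
_∧ₛ_ : Schema n → Schema n → Schema n
F ∧ₛ G = ¬ₛ (F ⇛ ¬ₛ G)

s₀ : Schema (suc n)
s₀ = atom zero

s₁ : Schema (suc (suc n))
s₁ = atom (suc zero)

s₂ : Schema (suc (suc (suc n)))
s₂ = atom (suc (suc zero))

s₃ : Schema (suc (suc (suc (suc n))))
s₃ = atom (suc (suc (suc zero)))

evalₛ : Vec Bool n → Schema n → Bool
evalₛ ρ (atom i) = lookup ρ i
evalₛ ρ falsum   = false
evalₛ ρ (F ⇛ G)  = not (evalₛ ρ F) ∨ evalₛ ρ G

instantiate : Vec Fm n → Schema n → Fm
instantiate σ (atom i) = lookup σ i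
instantiate σ falsum   = ⊥'
instantiate σ (F ⇛ G)  = instantiate σ F ⇒ instantiate σ G

evalB-instantiate : ∀ f (σ : Vec Fm n) F →
                    evalB f (instantiate σ F) ≡ evalₛ (map (evalB f) σ) F
evalB-instantiate f σ (atom i) = sym (lookup-map i (evalB f) σ)
evalB-instantiate f σ falsum   = refl
evalB-instantiate f σ (F ⇛ G)  =
  cong₂ (λ a b → not a ∨ b) (evalB-instantiate f σ F) (evalB-instantiate f σ G)

allValuations : ∀ n → (Vec Bool n → Bool) → Bool
allValuations zero    g = g []
allValuations (suc n) g =
  allValuations n (λ ρ → g (true ∷ ρ)) ∧ allValuations n (λ ρ → g (false ∷ ρ))

allValuations-sound : ∀ n g → T (allValuations n g) → ∀ ρ → T (g ρ)
allValuations-sound zero    g h []          = h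
allValuations-sound (suc n) g h (true ∷ ρ)  =
  allValuations-sound n _ (proj₁ (Equivalence.to T-∧ h)) ρ
allValuations-sound (suc n) g h (false ∷ ρ) =
  allValuations-sound n _ (proj₂ (Equivalence.to T-∧ h)) ρ

valid : Schema n → Bool
valid {n} F = allValuations n (λ ρ → evalₛ ρ F)

tautology : (F : Schema n) {_ : T (valid F)} (σ : Vec Fm n) → KT1⊢ instantiate σ F
tautology {n} F {v} σ = taut λ f →
  trans (evalB-instantiate f σ F)
        (Equivalence.to T-≡ (allValuations-sound n _ v (map (evalB f) σ)))

mp₂ : KT1⊢ (A ⇒ B ⇒ C) → KT1⊢ A → KT1⊢ B → KT1⊢ C
mp₂ d e f = mp (mp d e) f

⇒-refl : ∀ A → KT1⊢ (A ⇒ A)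
⇒-refl A = tautology (s₀ ⇛ s₀) (A ∷ [])

⇒-trans : KT1⊢ (A ⇒ B) → KT1⊢ (B ⇒ C) → KT1⊢ (A ⇒ C)
⇒-trans {A} {B} {C} =
  mp₂ (tautology ((s₀ ⇛ s₁) ⇛ (s₁ ⇛ s₂) ⇛ (s₀ ⇛ s₂)) (A ∷ B ∷ C ∷ []))

⊤' : Fm
⊤' = ~ ⊥'

⊢⊤' : KT1⊢ ⊤'
⊢⊤' = tautology (¬ₛ falsum) []

[p≔_] : Fm → Subst
[p≔ A ] zero    = A
[p≔ A ] (suc n) = var (suc n)

[p≔_,q≔_] : Fm → Fm → Subst
[p≔ A ,q≔ B ] zero          = A
[p≔ A ,q≔ B ] (suc zero)    = B
[p≔ A ,q≔ B ] (suc (suc n)) = var (suc (suc n))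

data Modality : Set where
  box diff : Modality

modal : Modality → Fm → Fm
modal box  = □
modal diff = [≠]

necessitation : ∀ μ → KT1⊢ A → KT1⊢ modal μ A
necessitation box  = nec□
necessitation diff = nec≠

distribution : ∀ μ A B → KT1⊢ (modal μ (A ⇒ B) ⇒ modal μ A ⇒ modal μ B)
distribution box  A B = subst [p≔ A ,q≔ B ] K□
distribution diff A B = subst [p≔ A ,q≔ B ] K≠

modal-mono : ∀ μ → KT1⊢ (A ⇒ B) → KT1⊢ (modal μ A ⇒ modal μ B)
modal-mono {A} {B} μ d = mp (distribution μ A B) (necessitation μ d)

modal-mono₂ : ∀ μ → KT1⊢ (A ⇒ B ⇒ C) → KT1⊢ (modal μ A ⇒ modal μ B ⇒ modal μ C)
modal-mono₂ {A} {B} {C} μ d = ⇒-trans (modal-mono μ d) (distribution μ B C)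

-- Enumerating formulas

-- Cantor's enumeration of ℕ × ℕ, diagonal by diagonal.
next : ℕ × ℕ → ℕ × ℕ
next (zero  , b) = suc b , zero
next (suc a , b) = a , suc b

unpair : ℕ → ℕ × ℕ
unpair zero    = 0 , 0
unpair (suc n) = next (unpair n)

diagonal : ℕ → ℕ → ℕ
diagonal zero    zero    = 0
diagonal (suc s) zero    = suc (diagonal s s)
diagonal s       (suc b) = suc (diagonal s b)

∸-suc : ∀ s b → b < s → s ∸ b ≡ suc (s ∸ suc b)
∸-suc (suc s) zero    _         = refl
∸-suc (suc s) (suc b) (s≤s b<s) = ∸-suc s b b<s

unpair-diagonal : ∀ s b → b ≤ s → unpair (diagonal s b) ≡ (s ∸ b , b)
unpair-diagonal zero    zero    _ = refl
unpair-diagonal (suc s) zero    _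
  rewrite unpair-diagonal s s ≤-refl | n∸n≡0 s = refl
unpair-diagonal (suc s) (suc b) b<s
  rewrite unpair-diagonal (suc s) b (≤-trans (n≤1+n b) b<s) | ∸-suc (suc s) b b<s = refl

pair : ℕ → ℕ → ℕ
pair a b = diagonal (a + b) b

unpair-pair : ∀ a b → unpair (pair a b) ≡ (a , b)
unpair-pair a b rewrite unpair-diagonal (a + b) b (m≤n+m b a) | m+n∸n≡m a b = refl

code : Fm → ℕ
code (var n) = pair 0 n
code ⊥'      = pair 1 0
code (A ⇒ B) = pair 2 (pair (code A) (code B))
code (□ A)   = pair 3 (code A)
code ([≠] A) = pair 4 (code A)

depth : Fm → ℕ
depth (var n) = 0
depth ⊥'      = 0
depth (A ⇒ B) = suc (depth A + depth B)
depth (□ A)   = suc (depth A)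
depth ([≠] A) = suc (depth A)

-- The first argument is fuel; it must exceed the depth of the decoded formula.
decode : ℕ → ℕ → Fm
decode zero    _ = ⊥'
decode (suc f) c with unpair c
... | 0 , m = var m
... | 2 , m with unpair m
...   | a , b = decode f a ⇒ decode f b
decode (suc f) c | 3 , m = □ (decode f m)
decode (suc f) c | 4 , m = [≠] (decode f m)
decode (suc f) c | _ , _ = ⊥'

decode-code : ∀ A f → depth A < f → decode f (code A) ≡ A
decode-code (var n) (suc f) _ rewrite unpair-pair 0 n = refl
decode-code ⊥'      (suc f) _ rewrite unpair-pair 1 0 = refl
decode-code (A ⇒ B) (suc f) (s≤s d<f)
  rewrite unpair-pair 2 (pair (code A) (code B)) | unpair-pair (code A) (code B)
        | decode-code A f (≤-trans (s≤s (m≤m+n (depth A) (depth B))) d<f)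
        | decode-code B f (≤-trans (s≤s (m≤n+m (depth B) (depth A))) d<f) = refl
decode-code (□ A)   (suc f) (s≤s d<f)
  rewrite unpair-pair 3 (code A) | decode-code A f d<f = refl
decode-code ([≠] A) (suc f) (s≤s d<f)
  rewrite unpair-pair 4 (code A) | decode-code A f d<f = refl

enumerate : ℕ → Fm
enumerate k = decode (proj₁ (unpair k)) (proj₂ (unpair k))

index : Fm → ℕ
index A = pair (suc (depth A)) (code A)

enumerate-index : ∀ A → enumerate (index A) ≡ A
enumerate-index A rewrite unpair-pair (suc (depth A)) (code A) =
  decode-code A (suc (depth A)) ≤-refl

-- Maximal consistent theories

Theory : Set
Theory = Fm → Bool

infix 4 _∈_ _∉_
_∈_ _∉_ : Fm → Theory → Set
A ∈ Γ = Γ A ≡ true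
A ∉ Γ = Γ A ≡ false

private variable
  Γ Γ′ Δ Δ′ Θ : Theory

clash : ∀ {b} → b ≡ true → b ≡ false → ⊥
clash refl ()

record MCS (Γ : Theory) : Set where
  field
    theorems : KT1⊢ A → A ∈ Γ
    ∈-mp     : A ⇒ B ∈ Γ → A ∈ Γ → B ∈ Γ
    ⊥'∉      : ⊥' ∉ Γ
    ∉⇒~∈     : A ∉ Γ → ~ A ∈ Γ

  ~∈⇒∉ : ~ A ∈ Γ → A ∉ Γ
  ~∈⇒∉ ~A∈ = ¬-not {y = true} λ A∈ → clash (∈-mp ~A∈ A∈) ⊥'∉

  ∈⇒~∉ : A ∈ Γ → ~ A ∉ Γ
  ∈⇒~∉ A∈ = ¬-not {y = true} λ ~A∈ → clash (∈-mp ~A∈ A∈) ⊥'∉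

  closed : KT1⊢ (A ⇒ B) → A ∈ Γ → B ∈ Γ
  closed d = ∈-mp (theorems d)

  closed₂ : KT1⊢ (A ⇒ B ⇒ C) → A ∈ Γ → B ∈ Γ → C ∈ Γ
  closed₂ d A∈ = ∈-mp (closed d A∈)

  ⇒-∈ : (A ∈ Γ → B ∈ Γ) → A ⇒ B ∈ Γ
  ⇒-∈ {A} {B} f with Γ A in e
  ... | true  = closed (tautology (s₁ ⇛ s₀ ⇛ s₁) (A ∷ B ∷ [])) (f refl)
  ... | false = closed (tautology (¬ₛ s₀ ⇛ s₀ ⇛ s₁) (A ∷ B ∷ [])) (∉⇒~∈ e)

Consistent : (Fm → Set) → Fm → Set
Consistent Hyp ψ = ∀ B → Hyp B → ¬ KT1⊢ (B ⇒ ~ ψ)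

-- Hyp is what the extension must contain: the theorems, or {B | □B ∈ Γ}, or {B | [≠]B ∈ Γ}.
module Lindenbaum (lem : ExcludedMiddle 0ℓ) (Hyp : Fm → Set) (Hyp-⊤' : Hyp ⊤')
                  (Hyp-∧' : ∀ {B C} → Hyp B → Hyp C → Hyp (B ∧' C)) (φ₀ : Fm) where

  extend : (ψ A : Fm) → Dec (Consistent Hyp (ψ ∧' A)) → Fm
  extend ψ A (yes _) = ψ ∧' A
  extend ψ A (no _)  = ψ ∧' (~ A)

  stage : ℕ → Fm
  stage zero    = φ₀
  stage (suc n) = extend (stage n) (enumerate n) lem

  -- Δ∞ contains A iff A was added when it was considered, at stage index A.
  Δ∞ : Theory
  Δ∞ A = isYes (lem {Consistent Hyp (stage (index A) ∧' enumerate (index A))})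

  literal : Fm → Bool → Fm
  literal A true  = A
  literal A false = ~ A

  extend-literal : ∀ ψ A d → KT1⊢ (extend ψ A d ⇒ literal A (isYes d))
  extend-literal ψ A (yes _) = tautology (s₀ ∧ₛ s₁ ⇛ s₁) (ψ ∷ A ∷ [])
  extend-literal ψ A (no _)  = tautology (s₀ ∧ₛ ¬ₛ s₁ ⇛ ¬ₛ s₁) (ψ ∷ A ∷ [])

  extend-weaker : ∀ ψ A d → KT1⊢ (extend ψ A d ⇒ ψ)
  extend-weaker ψ A (yes _) = tautology (s₀ ∧ₛ s₁ ⇛ s₀) (ψ ∷ A ∷ [])
  extend-weaker ψ A (no _)  = tautology (s₀ ∧ₛ ¬ₛ s₁ ⇛ s₀) (ψ ∷ A ∷ [])

  -- If both ψ ∧ A and ψ ∧ ~A are refuted by hypotheses B₁ and B₂, then B₁ ∧ B₂ refutes ψ.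
  extend-consistent : ∀ ψ A d → Consistent Hyp ψ → Consistent Hyp (extend ψ A d)
  extend-consistent ψ A (yes ψ∧A-consistent) _ = ψ∧A-consistent
  extend-consistent ψ A (no ψ∧A-inconsistent) ψ-consistent B₂ hyp₂ d₂ =
    ψ∧A-inconsistent λ B₁ hyp₁ d₁ →
      ψ-consistent (B₁ ∧' B₂) (Hyp-∧' hyp₁ hyp₂)
        (mp₂ (tautology ((s₀ ⇛ ¬ₛ (s₂ ∧ₛ s₃)) ⇛ (s₁ ⇛ ¬ₛ (s₂ ∧ₛ ¬ₛ s₃)) ⇛ (s₀ ∧ₛ s₁ ⇛ ¬ₛ s₂))
                        (B₁ ∷ B₂ ∷ ψ ∷ A ∷ []))
             d₁ d₂)

  stage-antitone′ : n ≤′ m → KT1⊢ (stage m ⇒ stage n)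
  stage-antitone′ {n} ≤′-refl = ⇒-refl (stage n)
  stage-antitone′ {m = suc m} (≤′-step n≤m) =
    ⇒-trans (extend-weaker (stage m) (enumerate m) lem) (stage-antitone′ n≤m)

  stage-antitone : n ≤ m → KT1⊢ (stage m ⇒ stage n)
  stage-antitone n≤m = stage-antitone′ (≤⇒≤′ n≤m)

  stage-decides : index A < m → KT1⊢ (stage m ⇒ literal A (Δ∞ A))
  stage-decides {A} i<m =
    ⇒-trans (stage-antitone i<m)
            (transport (λ X → KT1⊢ (stage (suc (index A)) ⇒ literal X (Δ∞ A)))
                       (enumerate-index A)
                       (extend-literal (stage (index A)) (enumerate (index A)) lem))

  stage-∈ : A ∈ Δ∞ → index A < m → KT1⊢ (stage m ⇒ A)
  stage-∈ {A} {m} e i<m = transport (λ b → KT1⊢ (stage m ⇒ literal A b)) e (stage-decides i<m)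

  stage-∉ : A ∉ Δ∞ → index A < m → KT1⊢ (stage m ⇒ ~ A)
  stage-∉ {A} {m} e i<m = transport (λ b → KT1⊢ (stage m ⇒ literal A b)) e (stage-decides i<m)

  module _ (φ₀-consistent : Consistent Hyp φ₀) where

    stage-consistent : ∀ n → Consistent Hyp (stage n)
    stage-consistent zero    = φ₀-consistent
    stage-consistent (suc n) =
      extend-consistent (stage n) (enumerate n) lem (stage-consistent n)

    stage-irrefutable : ∀ n → ¬ KT1⊢ (~ stage n)
    stage-irrefutable n d =
      stage-consistent n ⊤' Hyp-⊤' (mp (tautology (s₀ ⇛ s₁ ⇛ s₀) (~ stage n ∷ ⊤' ∷ [])) d)

    Δ∞-mcs : MCS Δ∞
    Δ∞-mcs = record
      { theorems = λ {A} → theorems {A}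
      ; ∈-mp     = λ {A} {B} → ∈-mp {A} {B}
      ; ⊥'∉      = ¬-not {y = true} λ e → stage-irrefutable (suc (index ⊥')) (stage-∈ e ≤-refl)
      ; ∉⇒~∈     = λ {A} → ∉⇒~∈ {A}
      }
      where
      theorems : KT1⊢ A → A ∈ Δ∞
      theorems {A} ⊢A = ¬-not {y = false} λ e → stage-irrefutable (suc (index A))
        (mp₂ (tautology ((s₀ ⇛ ¬ₛ s₁) ⇛ s₁ ⇛ ¬ₛ s₀) (stage (suc (index A)) ∷ A ∷ [])) (stage-∉ e ≤-refl) ⊢A)

      ∈-mp : A ⇒ B ∈ Δ∞ → A ∈ Δ∞ → B ∈ Δ∞
      ∈-mp {A} {B} A⇒B∈ A∈ = ¬-not {y = false} λ B∉ →
        let a = index (A ⇒ B) ; b = index A ; c = index B ; m = suc (a + b + c) in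
        stage-irrefutable m
          (mp (mp₂ (tautology ((s₀ ⇛ s₁ ⇛ s₂) ⇛ (s₀ ⇛ s₁) ⇛ (s₀ ⇛ ¬ₛ s₂) ⇛ ¬ₛ s₀)
                              (stage m ∷ A ∷ B ∷ []))
                   (stage-∈ A⇒B∈ (s≤s (≤-trans (m≤m+n a b) (m≤m+n (a + b) c))))
                   (stage-∈ A∈ (s≤s (≤-trans (m≤n+m b a) (m≤m+n (a + b) c)))))
              (stage-∉ B∉ (s≤s (m≤n+m c (a + b)))))

      ∉⇒~∈ : A ∉ Δ∞ → ~ A ∈ Δ∞
      ∉⇒~∈ {A} A∉ = ¬-not {y = false} λ ~A∉ →
        let a = index A ; b = index (~ A) ; m = suc (a + b) in
        stage-irrefutable m
          (mp₂ (tautology ((s₀ ⇛ ¬ₛ s₁) ⇛ (s₀ ⇛ ¬ₛ ¬ₛ s₁) ⇛ ¬ₛ s₀) (stage m ∷ A ∷ []))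
               (stage-∉ A∉ (s≤s (m≤m+n a b))) (stage-∉ ~A∉ (s≤s (m≤n+m b a))))

    Hyp⊆Δ∞ : Hyp B → B ∈ Δ∞
    Hyp⊆Δ∞ {B} hyp = ¬-not {y = false} λ B∉ →
      stage-consistent (suc (index B)) B hyp
        (mp (tautology ((s₀ ⇛ ¬ₛ s₁) ⇛ s₁ ⇛ ¬ₛ s₀) (stage (suc (index B)) ∷ B ∷ [])) (stage-∉ B∉ ≤-refl))

    φ₀∈Δ∞ : φ₀ ∈ Δ∞
    φ₀∈Δ∞ = ¬-not {y = false} λ φ₀∉ →
      stage-irrefutable (suc (index φ₀))
        (mp₂ (tautology ((s₀ ⇛ ¬ₛ s₁) ⇛ (s₀ ⇛ s₁) ⇛ ¬ₛ s₀) (stage (suc (index φ₀)) ∷ φ₀ ∷ []))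
             (stage-∉ φ₀∉ ≤-refl) (stage-antitone {m = suc (index φ₀)} z≤n))

lindenbaum : ExcludedMiddle 0ℓ → (Hyp : Fm → Set) → Hyp ⊤' →
             (∀ {B C} → Hyp B → Hyp C → Hyp (B ∧' C)) →
             (φ₀ : Fm) → Consistent Hyp φ₀ →
             Σ Theory λ Δ → MCS Δ × (∀ {B} → Hyp B → B ∈ Δ) × φ₀ ∈ Δ
lindenbaum lem Hyp Hyp-⊤' Hyp-∧' φ₀ φ₀-consistent =
  Δ∞ , Δ∞-mcs φ₀-consistent , Hyp⊆Δ∞ φ₀-consistent , φ₀∈Δ∞ φ₀-consistent
  where open Lindenbaum lem Hyp Hyp-⊤' Hyp-∧' φ₀

-- The canonical relations

Rel : Modality → Theory → Theory → Set
Rel μ Γ Δ = ∀ B → modal μ B ∈ Γ → B ∈ Δ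

infix 4 _R□_ _R≠_ _≈_
_R□_ _R≠_ : Theory → Theory → Set
_R□_ = Rel box
_R≠_ = Rel diff

_≈_ : Theory → Theory → Set
Γ ≈ Δ = ∀ F → Γ F ≡ Δ F

≈-sym : Γ ≈ Δ → Δ ≈ Γ
≈-sym e F = sym (e F)

∈-resp-≈ : ∀ A → Γ ≈ Δ → A ∈ Γ → A ∈ Δ
∈-resp-≈ A e A∈ = trans (sym (e A)) A∈

Rel-respˡ : ∀ μ → Γ ≈ Γ′ → Rel μ Γ Δ → Rel μ Γ′ Δ
Rel-respˡ _ Γ≈Γ′ r B h = r B (trans (Γ≈Γ′ _) h)

Rel-respʳ : ∀ μ → Δ ≈ Δ′ → Rel μ Γ Δ → Rel μ Γ Δ′
Rel-respʳ _ Δ≈Δ′ r B h = trans (sym (Δ≈Δ′ B)) (r B h)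

Separated : Theory → Theory → Set
Separated Γ Δ = Σ Fm λ G → G ∈ Γ × G ∉ Δ

≈-or-separated : ExcludedMiddle 0ℓ → MCS Γ → MCS Δ → Γ ≈ Δ ⊎ Separated Γ Δ
≈-or-separated {Γ} {Δ} lem MΓ MΔ with lem {Separated Γ Δ}
... | yes sep = inj₂ sep
... | no ¬sep = inj₁ agree
  where
  agree : Γ ≈ Δ
  agree F with Γ F in e₁ | Δ F in e₂
  ... | true  | true  = refl
  ... | false | false = refl
  ... | true  | false = ⊥-elim (¬sep (F , e₁ , e₂))
  ... | false | true  = ⊥-elim (¬sep (~ F , MCS.∉⇒~∈ MΓ e₁ , MCS.∈⇒~∉ MΔ e₂))

modal-witness : ExcludedMiddle 0ℓ → ∀ μ → MCS Γ → modal μ B ∉ Γ →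
                Σ Theory λ Δ → MCS Δ × Rel μ Γ Δ × B ∉ Δ
modal-witness {Γ} {B} lem μ MΓ μB∉
  with lindenbaum lem (λ X → modal μ X ∈ Γ) (theorems (necessitation μ ⊢⊤'))
         (λ {X} {Y} → closed₂ (modal-mono₂ μ (tautology (s₀ ⇛ s₁ ⇛ s₀ ∧ₛ s₁) (X ∷ Y ∷ []))))
         (~ B) consistent
  where
  open MCS MΓ
  consistent : Consistent (λ X → modal μ X ∈ Γ) (~ B)
  consistent X μX∈ d =
    clash (closed (modal-mono μ (⇒-trans d (tautology (¬ₛ ¬ₛ s₀ ⇛ s₀) (B ∷ [])))) μX∈) μB∉
... | Δ , MΔ , Hyp⊆Δ , ~B∈ = Δ , MΔ , (λ X → Hyp⊆Δ) , MCS.~∈⇒∉ MΔ ~B∈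

module _ {Γ : Theory} (MΓ : MCS Γ) where
  open MCS MΓ

  R□⇒R≠ : Γ R□ Δ → Γ R≠ Δ
  R□⇒R≠ r B h = r B (closed (subst [p≔ B ] ax≠□) h)

  R≠-sym : MCS Δ → Γ R≠ Δ → Δ R≠ Γ
  R≠-sym MΔ r B [≠]B∈ = ¬-not {y = false} λ B∉ →
    let X = [≠] (~ [≠] B)
        contraposed-B : KT1⊢ (~ B ⇒ X)
        contraposed-B = mp (tautology ((¬ₛ s₀ ⇛ s₁) ⇛ ¬ₛ s₁ ⇛ s₀) (X ∷ B ∷ []))
                           (subst [p≔ B ] axB)
    in clash [≠]B∈ (MCS.~∈⇒∉ MΔ (r (~ [≠] B) (closed contraposed-B (∉⇒~∈ B∉))))

  R□-trans : Γ R□ Δ → Δ R□ Θ → Γ R□ Θ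
  R□-trans r₁ r₂ B h = r₂ B (r₁ (□ B) (closed (subst [p≔ B ] ax4) h))

  R≠-R□-trans : Γ R≠ Δ → Δ R□ Θ → Γ R≠ Θ
  R≠-R□-trans r₁ r₂ B h = r₂ B (r₁ (□ B) (closed (subst [p≔ B ] ax≠≠□) h))

  -- Apply axD4 to ~G ⇒ B, where G separates Γ from Θ.
  R≠-weakly-trans : MCS Θ → Γ R≠ Δ → Δ R≠ Θ → Separated Γ Θ → Γ R≠ Θ
  R≠-weakly-trans {Θ} MΘ r₁ r₂ (G , G∈ , G∉) B [≠]B∈ = ¬-not {y = false} λ B∉ →
    let X = ~ G ⇒ B
        X∈ = closed (tautology (s₀ ⇛ ¬ₛ s₀ ⇛ s₁) (G ∷ B ∷ [])) G∈
        [≠]X∈ = closed (modal-mono diff (tautology (s₁ ⇛ ¬ₛ s₀ ⇛ s₁) (G ∷ B ∷ []))) [≠]B∈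
        X∧[≠]X∈ = closed₂ (tautology (s₀ ⇛ s₁ ⇛ s₀ ∧ₛ s₁) (X ∷ [≠] X ∷ [])) X∈ [≠]X∈
        [≠][≠]X∈ = closed (subst [p≔ X ] axD4) X∧[≠]X∈
    in clash (MCS.∈-mp MΘ (r₂ X (r₁ ([≠] X) [≠][≠]X∈)) (MCS.∉⇒~∈ MΘ G∉)) B∉

R□-target-reflexive : MCS Γ → MCS Δ → Γ R□ Δ → Δ R≠ Δ
R□-target-reflexive MΓ MΔ r = R≠-R□-trans MΔ (R≠-sym MΓ MΔ (R□⇒R≠ MΓ r)) r

Least : (ℕ → Set) → ℕ → Set
Least Q k = Q k × (∀ {j} → j < k → ¬ Q j)

least-witness : ExcludedMiddle 0ℓ → (Q : ℕ → Set) → Q n → Σ ℕ (Least Q)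
least-witness {n} lem Q = <-rec (λ n → Q n → Σ ℕ (Least Q)) step n
  where
  step : ∀ n → (∀ {j} → j < n → Q j → Σ ℕ (Least Q)) → Q n → Σ ℕ (Least Q)
  step n rec Qn with lem {Σ ℕ λ j → j < n × Q j}
  ... | yes (j , j<n , Qj) = rec j<n Qj
  ... | no none            = n , Qn , λ j<n Qj → none (_ , j<n , Qj)

-- The canonical T1 space

module Canonical (lem : ExcludedMiddle 0ℓ) {Γ₀ : Theory} (M₀ : MCS Γ₀) where

  InCluster : Theory → Set
  InCluster Δ = Δ ≈ Γ₀ ⊎ Γ₀ R≠ Δ

  separated⇒R≠ : MCS Γ → MCS Δ → InCluster Γ → InCluster Δ → Separated Γ Δ → Γ R≠ Δ
  separated⇒R≠ _  _  (inj₁ Γ≈) (inj₁ Δ≈) (G , G∈ , G∉) =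
    ⊥-elim (clash (∈-resp-≈ G (≈-sym Δ≈) (∈-resp-≈ G Γ≈ G∈)) G∉)
  separated⇒R≠ _  _  (inj₁ Γ≈) (inj₂ r)  _   = Rel-respˡ diff (≈-sym Γ≈) r
  separated⇒R≠ {Γ} MΓ _ (inj₂ r) (inj₁ Δ≈) _ = Rel-respʳ {Γ = Γ} diff (≈-sym Δ≈) (R≠-sym M₀ MΓ r)
  separated⇒R≠ MΓ MΔ (inj₂ r₁) (inj₂ r₂) sep = R≠-weakly-trans MΓ MΔ (R≠-sym M₀ MΓ r₁) r₂ sep

  R≠-closed : MCS Γ → InCluster Γ → MCS Δ → Γ R≠ Δ → InCluster Δ
  R≠-closed _ (inj₁ Γ≈) _  r = inj₂ (Rel-respˡ diff Γ≈ r)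
  R≠-closed _ (inj₂ r₀) MΔ r with ≈-or-separated lem M₀ MΔ
  ... | inj₁ Γ₀≈Δ = inj₁ (≈-sym Γ₀≈Δ)
  ... | inj₂ sep  = inj₂ (R≠-weakly-trans M₀ MΔ r₀ r sep)

  record Reflexive (Δ : Theory) : Set where
    field
      mcs       : MCS Δ
      inCluster : InCluster Δ
      reflexive : Δ R≠ Δ

  record Names (k : ℕ) (Δ : Theory) : Set where
    field
      named∈ : enumerate k ∈ Δ
      unique : MCS Θ → InCluster Θ → enumerate k ∈ Θ → Θ ≈ Δ

  Names-resp : Δ ≈ Δ′ → Names n Δ → Names n Δ′
  Names-resp {n = n} Δ≈Δ′ N = record
    { named∈ = ∈-resp-≈ (enumerate n) Δ≈Δ′ (Names.named∈ N)
    ; unique = λ MΘ CΘ h F → trans (Names.unique N MΘ CΘ h F) (Δ≈Δ′ F)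
    }

  record Named (k : ℕ) : Set where
    field
      theory    : Theory
      mcs       : MCS theory
      inCluster : InCluster theory
      names     : Names k theory
      least     : ∀ {j} → j < k → ¬ Names j theory

  -- An irreflexive theory is named by the least index of a formula singling it out, so
  -- it yields a single point; storing the data as True (lem …) makes proofs irrelevant.
  data Point : Set where
    copy  : (Δ : Theory) → ℕ → True (lem {Reflexive Δ}) → Point
    named : (k : ℕ) → True (lem {Named k}) → Point

  theory : Point → Theory
  theory (copy Δ _ _) = Δ
  theory (named _ t)  = Named.theory (toWitness t)

  mcs : ∀ x → MCS (theory x)
  mcs (copy _ _ t) = Reflexive.mcs (toWitness t)
  mcs (named _ t)  = Named.mcs (toWitness t)

  inCluster : ∀ x → InCluster (theory x)
  inCluster (copy _ _ t) = Reflexive.inCluster (toWitness t)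
  inCluster (named _ t)  = Named.inCluster (toWitness t)

  level : Point → ℕ
  level (copy _ n _) = n
  level (named _ _)  = 0

  same-theory⇒R≠ : ∀ x y → x ≢ y → theory x ≈ theory y → theory x R≠ theory y
  same-theory⇒R≠ (copy Δ _ t) _ _ x≈y =
    Rel-respʳ {Γ = Δ} diff x≈y (Reflexive.reflexive (toWitness t))
  same-theory⇒R≠ (named _ _) (copy _ _ t) _ x≈y =
    Rel-respˡ diff (≈-sym x≈y) (Reflexive.reflexive (toWitness t))
  same-theory⇒R≠ (named k t) (named k′ t′) x≢y x≈y with <-cmp k k′
  ... | tri≈ _ refl _ = ⊥-elim (x≢y (cong (named k) (T-irrelevant t t′)))
  ... | tri< k<k′ _ _ =
    ⊥-elim (Named.least (toWitness t′) k<k′ (Names-resp x≈y (Named.names (toWitness t))))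
  ... | tri> _ _ k′<k =
    ⊥-elim (Named.least (toWitness t) k′<k (Names-resp (≈-sym x≈y) (Named.names (toWitness t′))))

  distinct⇒R≠ : ∀ x y → x ≢ y → theory x R≠ theory y
  distinct⇒R≠ x y x≢y with ≈-or-separated lem (mcs x) (mcs y)
  ... | inj₁ x≈y = same-theory⇒R≠ x y x≢y x≈y
  ... | inj₂ sep = separated⇒R≠ (mcs x) (mcs y) (inCluster x) (inCluster y) sep

  -- An irreflexive Δ contains [≠]B and ~B for some B, and ~B ∧ [≠]B singles it out.
  irreflexive-named : MCS Δ → InCluster Δ → ¬ Δ R≠ Δ → Σ ℕ λ k → Names k Δ
  irreflexive-named {Δ} MΔ CΔ irr with lem {Σ Fm λ B → [≠] B ∈ Δ × B ∉ Δ}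
  ... | no none = ⊥-elim (irr λ B h → ¬-not {y = false} λ B∉ → none (B , h , B∉))
  ... | yes (B , [≠]B∈ , B∉) =
    index G ,
    record { named∈ = transport (_∈ Δ) (sym (enumerate-index G)) G∈ ; unique = unique }
    where
    G = (~ B) ∧' [≠] B
    G∈ : G ∈ Δ
    G∈ = MCS.closed₂ MΔ (tautology (s₀ ⇛ s₁ ⇛ s₀ ∧ₛ s₁) (~ B ∷ [≠] B ∷ []))
                        (MCS.∉⇒~∈ MΔ B∉) [≠]B∈
    unique : MCS Θ → InCluster Θ → enumerate (index G) ∈ Θ → Θ ≈ Δ
    unique {Θ} MΘ CΘ h with ≈-or-separated lem MΘ MΔ
    ... | inj₁ Θ≈Δ = Θ≈Δ
    ... | inj₂ sep =
      let G∈Θ = transport (_∈ Θ) (enumerate-index G) h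
          ~B∈Θ = MCS.closed MΘ (tautology (s₀ ∧ₛ s₁ ⇛ s₀) (~ B ∷ [≠] B ∷ [])) G∈Θ
          B∈Θ = R≠-sym MΘ MΔ (separated⇒R≠ MΘ MΔ CΘ CΔ sep) B [≠]B∈
      in ⊥-elim (clash B∈Θ (MCS.~∈⇒∉ MΘ ~B∈Θ))

  irreflexive-point : MCS Δ → InCluster Δ → ¬ Δ R≠ Δ → Σ Point λ y → theory y ≈ Δ
  irreflexive-point {Δ} MΔ CΔ irr
    with least-witness lem (λ j → Names j Δ) (proj₂ (irreflexive-named MΔ CΔ irr))
  ... | k , names , least =
    named k t , ≈-sym (Names.unique (Named.names (toWitness t)) MΔ CΔ (Names.named∈ names))
    where
    t : True (lem {Named k})
    t = fromWitness (record { theory = Δ ; mcs = MΔ ; inCluster = CΔ ; names = names ; least = least })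

  realise : MCS Δ → InCluster Δ → ∀ n → Σ Point λ y → theory y ≈ Δ × (Δ R≠ Δ → level y ≡ n)
  realise {Δ} MΔ CΔ n with lem {Δ R≠ Δ}
  ... | yes refl-Δ =
    copy Δ n (fromWitness (record { mcs = MΔ ; inCluster = CΔ ; reflexive = refl-Δ })) ,
    (λ _ → refl) , λ _ → refl
  ... | no irr with irreflexive-point MΔ CΔ irr
  ...   | y , y≈Δ = y , y≈Δ , λ refl-Δ → ⊥-elim (irr refl-Δ)

  realise-elsewhere : MCS Δ → InCluster Δ → ∀ x → theory x R≠ Δ →
                      Σ Point λ y → theory y ≈ Δ × y ≢ x
  realise-elsewhere {Δ} MΔ CΔ x r with realise MΔ CΔ (suc (level x))
  ... | y , y≈Δ , lvl = y , y≈Δ , λ { refl → 1+n≢n (sym (lvl (Rel-respˡ diff y≈Δ r))) }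

  IsOpen : (Point → Set) → Set
  IsOpen U = ∀ x → U x → Σ ℕ λ k → ∀ y → theory x R□ theory y → k ≤ level y → U y

  cone : Point → ℕ → Point → Set
  cone x k y = y ≡ x ⊎ (theory x R□ theory y × k ≤ level y)

  cone-open : ∀ x k → IsOpen (cone x k)
  cone-open x k _ (inj₁ refl)     = k , λ y r k≤ → inj₂ (r , k≤)
  cone-open x k _ (inj₂ (r₁ , _)) = k , λ y r k≤ → inj₂ (R□-trans (mcs x) r₁ r , k≤)

  topology : Topology Point
  topology = record
    { Open      = IsOpen
    ; open-univ = λ _ _ → 0 , λ _ _ _ → tt
    ; open-∩    = λ U-open V-open x (Ux , Vx) →
        let (k₁ , U-cone) = U-open x Ux ; (k₂ , V-cone) = V-open x Vx in
        k₁ + k₂ , λ y r k≤ → U-cone y r (≤-trans (m≤m+n k₁ k₂) k≤) ,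
                             V-cone y r (≤-trans (m≤n+m k₂ k₁) k≤)
    ; open-⋃    = λ I U U-open x (i , Uᵢx) →
        let (k , Uᵢ-cone) = U-open i x Uᵢx in k , λ y r k≤ → i , Uᵢ-cone y r k≤
    }

  space : T1Space
  space = record
    { Carrier  = Point
    ; topology = topology
    ; T1       = λ x y x≢y →
        cone x (suc (level y)) , cone-open x (suc (level y)) , inj₁ refl ,
        λ { (inj₁ y≡x) → x≢y (sym y≡x) ; (inj₂ (_ , y<y)) → <-irrefl refl y<y }
    }

  valuation : Valuation Point
  valuation k x = var k ∈ theory x

  Sat : Point → Fm → Set₁
  Sat x B = _,_⊨_ space valuation x B

  Truth : Fm → Set₁
  Truth B = ∀ x → Sat x B ⇔ B ∈ theory x

  truth-□ : Truth B → Truth (□ B)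
  truth-□ {B} truth-B x = mk⇔ to from
    where
    to : Sat x (□ B) → □ B ∈ theory x
    to (U , U-open , Ux , U-sat) = ¬-not {y = false} λ □B∉ →
      let (Δ , MΔ , r , B∉) = modal-witness lem box (mcs x) □B∉
          CΔ = R≠-closed (mcs x) (inCluster x) MΔ (R□⇒R≠ (mcs x) r)
          (k , U-cone) = U-open x Ux
          (y , y≈Δ , lvl) = realise MΔ CΔ (k + suc (level x))
          y-level = lvl (R□-target-reflexive (mcs x) MΔ r)
          Uy = U-cone y (Rel-respʳ {Γ = theory x} box (≈-sym y≈Δ) r)
                        (transport (k ≤_) (sym y-level) (m≤m+n k (suc (level x))))
          y≢x : y ≢ x
          y≢x y≡x = <-irrefl (cong level (sym y≡x))
                             (transport (level x <_) (sym y-level) (m≤n+m (suc (level x)) k))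
      in clash (∈-resp-≈ B y≈Δ (Equivalence.to (truth-B y) (U-sat y Uy y≢x))) B∉
    from : □ B ∈ theory x → Sat x (□ B)
    from □B∈ = cone x 0 , cone-open x 0 , inj₁ refl , sat
      where
      sat : ∀ y → cone x 0 y → y ≢ x → Sat y B
      sat y (inj₁ y≡x)  y≢x = ⊥-elim (y≢x y≡x)
      sat y (inj₂ (r , _)) _ = Equivalence.from (truth-B y) (r B □B∈)

  truth-[≠] : Truth B → Truth ([≠] B)
  truth-[≠] {B} truth-B x = mk⇔ to from
    where
    to : Sat x ([≠] B) → [≠] B ∈ theory x
    to sat = ¬-not {y = false} λ [≠]B∉ →
      let (Δ , MΔ , r , B∉) = modal-witness lem diff (mcs x) [≠]B∉
          (y , y≈Δ , y≢x) = realise-elsewhere MΔ (R≠-closed (mcs x) (inCluster x) MΔ r) x r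
      in clash (∈-resp-≈ B y≈Δ (Equivalence.to (truth-B y) (sat y y≢x))) B∉
    from : [≠] B ∈ theory x → Sat x ([≠] B)
    from [≠]B∈ y y≢x =
      Equivalence.from (truth-B y) (distinct⇒R≠ x y (λ x≡y → y≢x (sym x≡y)) B [≠]B∈)

  truth : ∀ B → Truth B
  truth (var n) x = mk⇔ lower lift
  truth ⊥'      x = mk⇔ (λ ()) (λ ⊥'∈ → ⊥-elim (clash ⊥'∈ (MCS.⊥'∉ (mcs x))))
  truth (A ⇒ B) x = mk⇔
    (λ sat → MCS.⇒-∈ (mcs x) (Equivalence.to (truth B x) ∘ sat ∘ Equivalence.from (truth A x)))
    (λ A⇒B∈ → Equivalence.from (truth B x) ∘ MCS.∈-mp (mcs x) A⇒B∈ ∘ Equivalence.to (truth A x))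
  truth (□ B)   = truth-□ (truth B)
  truth ([≠] B) = truth-[≠] (truth B)

  omitted⇒invalid : A ∉ Γ₀ → ¬ Ld≠ space A
  omitted⇒invalid {A} A∉ valid =
    let (x₀ , x₀≈Γ₀ , _) = realise M₀ (inj₁ (λ _ → refl)) 0
    in clash (∈-resp-≈ A x₀≈Γ₀ (Equivalence.to (truth A x₀) (valid valuation x₀))) A∉

-- Soundness

isYes≡true⇔ : ∀ {a} {P : Set a} (d : Dec P) → isYes d ≡ true ⇔ P
isYes≡true⇔ (yes p) = mk⇔ (λ _ → p) (λ _ → refl)
isYes≡true⇔ (no ¬p) = mk⇔ (λ ()) (λ p → ⊥-elim (¬p p))

module Soundness (lem₀ : ExcludedMiddle 0ℓ) (lem₁ : ExcludedMiddle (lsuc 0ℓ)) (S : T1Space) where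
  open T1Space S

  Sat : Valuation Carrier → Carrier → Fm → Set₁
  Sat V x B = _,_⊨_ S V x B

  ¬¬-elim : {P : Set₁} → ¬ ¬ P → P
  ¬¬-elim = decidable-stable lem₁

  ∧'-elim : ∀ {V x} → Sat V x (A ∧' B) → Sat V x A × Sat V x B
  ∧'-elim sat = ¬¬-elim (λ ¬a → lower (sat λ a _ → lift (¬a a))) ,
                ¬¬-elim (λ ¬b → lower (sat λ _ b → lift (¬b b)))

  punctured-neighbourhood : ∀ y x → y ≢ x →
                            Σ (Carrier → Set) λ W → Open W × W y × (∀ z → W z → z ≢ x)
  punctured-neighbourhood y x y≢x with T1 y x y≢x
  ... | W , W-open , Wy , ¬Wx = W , W-open , Wy , λ { z Wz refl → ¬Wx Wz }

  evalB-sat : ∀ V x B → evalB (λ C → isYes (lem₁ {Sat V x C})) B ≡ true ⇔ Sat V x B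
  evalB-sat V x (var n) = isYes≡true⇔ lem₁
  evalB-sat V x ⊥'      = mk⇔ (λ ()) (λ ⊥-holds → ⊥-elim (lower ⊥-holds))
  evalB-sat V x (□ B)   = isYes≡true⇔ lem₁
  evalB-sat V x ([≠] B) = isYes≡true⇔ lem₁
  evalB-sat V x (A ⇒ B) = mk⇔ to from
    where
    value = evalB (λ C → isYes (lem₁ {Sat V x C}))
    to : value (A ⇒ B) ≡ true → Sat V x (A ⇒ B)
    to h satA with value A in eA
    ... | true  = Equivalence.to (evalB-sat V x B) h
    ... | false = ⊥-elim (clash (Equivalence.from (evalB-sat V x A) satA) eA)
    from : Sat V x (A ⇒ B) → value (A ⇒ B) ≡ true
    from sat with value A in eA
    ... | false = refl
    ... | true  = Equivalence.from (evalB-sat V x B) (sat (Equivalence.to (evalB-sat V x A) eA))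

  module _ (σ : Subst) (V : Valuation Carrier) where

    substituted : Valuation Carrier
    substituted k y = True (lem₁ {Sat V y (σ k)})

    sub-sat : ∀ C y → Sat substituted y C ⇔ Sat V y (sub σ C)
    sub-sat (var k) y = mk⇔ (toWitness ∘ lower) (lift ∘ fromWitness)
    sub-sat ⊥'      y = mk⇔ (λ ⊥-holds → ⊥-holds) (λ ⊥-holds → ⊥-holds)
    sub-sat (A ⇒ B) y = mk⇔
      (λ f → Equivalence.to (sub-sat B y) ∘ f ∘ Equivalence.from (sub-sat A y))
      (λ f → Equivalence.from (sub-sat B y) ∘ f ∘ Equivalence.to (sub-sat A y))
    sub-sat (□ A)   y = mk⇔
      (λ (U , U-open , Uy , f) → U , U-open , Uy , λ z Uz z≢y → Equivalence.to (sub-sat A z) (f z Uz z≢y))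
      (λ (U , U-open , Uy , f) → U , U-open , Uy , λ z Uz z≢y → Equivalence.from (sub-sat A z) (f z Uz z≢y))
    sub-sat ([≠] A) y = mk⇔
      (λ f z z≢y → Equivalence.to (sub-sat A z) (f z z≢y))
      (λ f z z≢y → Equivalence.from (sub-sat A z) (f z z≢y))

  sound : KT1⊢ A → ∀ V x → Sat V x A
  sound (taut t) V x = Equivalence.to (evalB-sat V x _) (t _)
  sound K□ V x (U₁ , U₁-open , U₁x , f) (U₂ , U₂-open , U₂x , g) =
    (λ z → U₁ z × U₂ z) , open-∩ U₁-open U₂-open , (U₁x , U₂x) ,
    λ y (U₁y , U₂y) y≢x → f y U₁y y≢x (g y U₂y y≢x)
  sound K≠ V x f g y y≢x = f y y≢x (g y y≢x)
  sound ax4 V x (U , U-open , Ux , f) = U , U-open , Ux , λ y Uy y≢x →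
    let (W , W-open , Wy , W∌x) = punctured-neighbourhood y x y≢x in
    (λ z → U z × W z) , open-∩ U-open W-open , (Uy , Wy) , λ z (Uz , Wz) _ → f z Uz (W∌x z Wz)
  sound axD4 V x p∧[≠]p y _ z _ with lem₀ {z ≡ x} | ∧'-elim {p} {[≠] p} {V} {x} p∧[≠]p
  ... | yes refl | px , _   = px
  ... | no z≢x   | _ , [≠]p = [≠]p z z≢x
  sound axB V x ⟨≠⟩[≠]p = ¬¬-elim λ ¬px →
    lower (⟨≠⟩[≠]p λ y y≢x [≠]p → lift (¬px ([≠]p x λ x≡y → y≢x (sym x≡y))))
  sound ax≠□ V x [≠]p = (λ _ → ⊤) , open-univ , tt , λ y _ y≢x → [≠]p y y≢x
  sound ax≠≠□ V x [≠]p y y≢x =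
    let (W , W-open , Wy , W∌x) = punctured-neighbourhood y x y≢x in
    W , W-open , Wy , λ z Wz _ → [≠]p z (W∌x z Wz)
  sound (mp d e)    V x = sound d V x (sound e V x)
  sound (nec□ d)    V x = (λ _ → ⊤) , open-univ , tt , λ y _ _ → sound d V y
  sound (nec≠ d)    V x = λ y _ → sound d V y
  sound (subst σ d) V x = Equivalence.to (sub-sat σ V _ x) (sound d (substituted σ V) x)

soundness : ExcludedMiddle 0ℓ → ExcludedMiddle (lsuc 0ℓ) → KT1⊢ A → ∀ X → Ld≠ X A
soundness lem₀ lem₁ ⊢A X = Soundness.sound lem₀ lem₁ X ⊢A

completeness : ExcludedMiddle 0ℓ → (∀ X → Ld≠ X A) → KT1⊢ A
completeness {A} lem valid with lem {KT1⊢ A}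
... | yes ⊢A = ⊢A
... | no ⊬A with lindenbaum lem KT1⊢_ ⊢⊤'
                   (λ {B} {C} → mp₂ (tautology (s₀ ⇛ s₁ ⇛ s₀ ∧ₛ s₁) (B ∷ C ∷ [])))
                   (~ A) consistent
  where
  consistent : Consistent KT1⊢_ (~ A)
  consistent B ⊢B d = ⊬A (mp₂ (tautology (s₀ ⇛ (s₀ ⇛ ¬ₛ ¬ₛ s₁) ⇛ s₁) (B ∷ A ∷ [])) ⊢B d)
...   | Γ₀ , M₀ , _ , ~A∈ =
  ⊥-elim (Canonical.omitted⇒invalid lem M₀ (MCS.~∈⇒∉ M₀ ~A∈) (valid (Canonical.space lem M₀)))

corollary7p13 : (∀ {ℓ : Level} → ExcludedMiddle ℓ) →
                ∀ (A : Fm) → ((∀ (X : T1Space) → Ld≠ X A) → KT1⊢ A)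
                             × (KT1⊢ A → ∀ (X : T1Space) → Ld≠ X A)
corollary7p13 lem A = completeness lem , soundness lem lem
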